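{- For an integer $m\ge 3$, let $G_{4m}$ be the graph with vertex set $\{x,y,z\}\cup\{y_1,\dots,y_{2m-2}\}\cup\{z_1,\dots,z_{2m-1}\}$ and edge set $\{yz\}\cup\{xy_i,\ y_iy: 1\le i\le 2m-2\}\cup\{xz_i,\ z_iz: 1\le i\le 2m-1\}\cup\{y_iy_j: 1\le i<j\le 2m-2,\ j\ne i+m-1\}\cup\{z_iz_{1+((i+m-2)\bmod (2m-1))}: 1\le i\le 2m-1\}\cup\{y_iz_j: 1\le i\le 2m-2,\ 1\le j\le 2m-1,\ j\ne i,\ j\ne i+1\}\cup\{y_1z_2\}$. Then $\gamma_t(G_{4m}-v)=2$ for every vertex $v\in V(G_{4m})$.
   Context: A set $S\subseteq V(G)$ is a total dominating set of a graph $G$ if every vertex of $G$ (including those in $S$) is adjacent to some vertex of $S$; $\gamma_t(G)$ is the minimum cardinality of a total dominating set. -}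

module Defs where

open import Data.Nat using (ℕ; suc; _+_; _*_; _∸_; _<_; _≤_)
open import Data.Nat.DivMod using (_%_)
open import Data.Fin using (Fin; toℕ)
open import Data.List using (List; length)
open import Data.List.Relation.Unary.All using (All)
open import Data.List.Relation.Unary.Any using (Any)
open import Data.List.Relation.Unary.Unique.Propositional using (Unique)
open import Data.Product using (_×_; ∃)
open import Data.Sum using (_⊎_)
open import Data.Unit using (⊤)
open import Data.Empty using (⊥)
open import Relation.Binary.PropositionalEquality using (_≡_; _≢_)

-- Finite vertex sets are duplicate-free lists.

IsTotalDominatingSet : {V : Set} → (InG : V → Set) → (Adj : V → V → Set)
                     → List V → Set
IsTotalDominatingSet InG Adj S =
  All InG S × (∀ w → InG w → Any (Adj w) S)

TotalDominationNumber : {V : Set} → (InG : V → Set) → (Adj : V → V → Set)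
                      → ℕ → Set
TotalDominationNumber {V} InG Adj k =
  (∃ λ (S : List V) → Unique S × length S ≡ k × IsTotalDominatingSet InG Adj S)
  × (∀ (S : List V) → Unique S → IsTotalDominatingSet InG Adj S → k ≤ length S)

-- Vertices: x, y, z, y_{i} (i = 1..2m-2), z_{j} (j = 1..2m-1).
-- `yv i` with i : Fin (2m-2) stands for y_{toℕ i + 1};
-- `zv j` with j : Fin (2m-1) stands for z_{toℕ j + 1}.
-- (2m-1 is written suc (2*m ∸ 2), equal to 2m-1 for m ≥ 1.)

data Vtx (m : ℕ) : Set where
  vx vy vz : Vtx m
  yv : Fin (2 * m ∸ 2) → Vtx m
  zv : Fin (suc (2 * m ∸ 2)) → Vtx m

-- the listed (unordered) edges, given in one orientation
Edge : (m : ℕ) → Vtx m → Vtx m → Set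
Edge m vy vz = ⊤
Edge m vx (yv i) = ⊤
Edge m (yv i) vy = ⊤
Edge m vx (zv j) = ⊤
Edge m (zv j) vz = ⊤
Edge m (yv i) (yv j) =
  (toℕ i + 1 < toℕ j + 1) × (toℕ j + 1 ≢ (toℕ i + 1) + m ∸ 1)
Edge m (zv i) (zv j) =
  toℕ j + 1 ≡ 1 + (((toℕ i + 1) + m ∸ 2) % suc (2 * m ∸ 2))
Edge m (yv i) (zv j) =
  ((toℕ j + 1 ≢ toℕ i + 1) × (toℕ j + 1 ≢ (toℕ i + 1) + 1))
  ⊎ ((toℕ i + 1 ≡ 1) × (toℕ j + 1 ≡ 2))
Edge m _ _ = ⊥

Adj : (m : ℕ) → Vtx m → Vtx m → Set
Adj m u w = Edge m u w ⊎ Edge m w u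

InMinus : {m : ℕ} → Vtx m → Vtx m → Set
InMinus v w = w ≢ v

AdjMinus : (m : ℕ) → Vtx m → Vtx m → Vtx m → Set
AdjMinus m v u w = InMinus v u × InMinus v w × Adj m u w

module Submission where

-- Put d = m - 1 and index the y's by 0 .. 2d-1 and the z's by 0 .. 2d. Since G_{4m} has no loops, no
-- single vertex is a total dominating set. For the upper bound, {y,z}, {x,z_0} and {x,y_0} dominate
-- G - x, G - y and G - z. For v = y_k or z_k take an edge y_a z_b avoiding v: y_a misses only its
-- antipodes y_{a±d} and z_a, z_{a+1}, so a is chosen to make v one of these misses (a the antipode of k,
-- resp. a ∈ {k-1, k}) and b so that z_b covers the others, using that z_i z_j is an edge exactly when
-- j ≡ i ± d (mod 2d+1).

open import Defs
open import Data.Nat using (ℕ; suc; _+_; _*_; _∸_; _<_; _≤_; z≤n; s≤s; _≟_; _<?_; _≤?_; s≤s⁻¹)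
open import Data.Nat.Properties
open import Data.Nat.DivMod using (_%_; m<n⇒m%n≡m; [m+n]%n≡m%n)
open import Data.Nat.Tactic.RingSolver using (solve-∀)
open import Data.Fin as Fin using (Fin; toℕ; fromℕ<)
open import Data.Fin.Properties using (toℕ<n; toℕ-fromℕ<; toℕ-injective)
open import Data.List using (List; []; _∷_; length)
open import Data.List.Relation.Unary.All using (_∷_; [])
open import Data.List.Relation.Unary.Any using (Any; here; there)
open import Data.List.Relation.Unary.AllPairs using (_∷_; [])
open import Data.List.Relation.Unary.Unique.Propositional using (Unique)
open import Data.Product using (Σ; _×_; _,_; ∃)
open import Data.Sum using (_⊎_; inj₁; inj₂)
open import Data.Unit using (tt)
open import Data.Empty using (⊥-elim)
open import Relation.Nullary using (¬_; yes; no)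
open import Relation.Binary.Definitions using (tri<; tri≈; tri>)
open import Relation.Binary.PropositionalEquality
open import Function using (_∘_)

totalDominatingSet-length≥2 : {V : Set} {InG : V → Set} {Adj : V → V → Set}
  → (∀ u → ¬ Adj u u) → ∃ InG → (S : List V) → IsTotalDominatingSet InG Adj S → 2 ≤ length S
totalDominatingSet-length≥2 irrefl (w , w∈G) [] (_ , dominated) with dominated w w∈G
... | ()
totalDominatingSet-length≥2 irrefl _ (s ∷ []) (s∈G ∷ [] , dominated) with dominated s s∈G
... | here s~s = ⊥-elim (irrefl s s~s)
totalDominatingSet-length≥2 irrefl _ (_ ∷ _ ∷ _) _ = s≤s (s≤s z≤n)

module G₄ₘ (n : ℕ) where

  m d : ℕ
  m = 3 + n
  d = 2 + n

  N M : ℕ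
  N = 2 * m ∸ 2
  M = suc N

  N≡d+d : N ≡ d + d
  N≡d+d = cong suc (trans (cong (λ k → n + (3 + k)) (+-identityʳ n)) (+-suc n (2 + n)))

  M≡2d+1 : M ≡ suc (d + d)
  M≡2d+1 = cong suc N≡d+d

  yIndex : ∀ a → a < d + d → Σ (Fin N) λ i → toℕ i ≡ a
  yIndex a a<2d = fromℕ< (subst (a <_) (sym N≡d+d) a<2d) , toℕ-fromℕ< _

  zIndex : ∀ b → b < suc (d + d) → Σ (Fin M) λ j → toℕ j ≡ b
  zIndex b b<2d+1 = fromℕ< (subst (b <_) (sym M≡2d+1) b<2d+1) , toℕ-fromℕ< _

  yIndex< : (i : Fin N) → toℕ i < d + d
  yIndex< i = subst (toℕ i <_) N≡d+d (toℕ<n i)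

  zIndex< : (j : Fin M) → toℕ j < suc (d + d)
  zIndex< j = subst (toℕ j <_) M≡2d+1 (toℕ<n j)

  yv-injective : ∀ {i j : Fin N} → yv {m} i ≡ yv j → toℕ i ≡ toℕ j
  yv-injective refl = refl

  zv-injective : ∀ {i j : Fin M} → zv {m} i ≡ zv j → toℕ i ≡ toℕ j
  zv-injective refl = refl

  %M-id : ∀ {x} → x < suc (d + d) → x % M ≡ x
  %M-id {x} x< = m<n⇒m%n≡m (subst (x <_) (sym M≡2d+1) x<)

  %M-wrap : ∀ {x} → x < suc (d + d) → (x + suc (d + d)) % M ≡ x
  %M-wrap {x} x< = trans (cong (λ k → (x + k) % M) (sym M≡2d+1)) (trans ([m+n]%n≡m%n x M) (%M-id x<))

  -- In 0-based indices (Fin position a stands for y_{a+1} resp. z_{a+1}), YZ a b says that y_a z_b is an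
  -- edge and ZStep i j that z_i z_j is an edge.
  YZ : ℕ → ℕ → Set
  YZ a b = (b ≢ a × b ≢ suc a) ⊎ (a ≡ 0 × b ≡ 1)

  ZStep : ℕ → ℕ → Set
  ZStep i j = j ≡ (i + d) % M

  +1≡suc : ∀ t → t + 1 ≡ suc t
  +1≡suc t = +-comm t 1

  +1+m∸1 : ∀ t → t + 1 + m ∸ 1 ≡ suc (t + d)
  +1+m∸1 t = trans (cong (_∸ 1) (+-suc (t + 1) d)) (cong (_+ d) (+1≡suc t))

  +1+m∸2 : ∀ t → t + 1 + m ∸ 2 ≡ t + d
  +1+m∸2 t = trans (cong (_∸ 2) (+-suc (t + 1) d)) (cong (λ k → k + d ∸ 1) (+1≡suc t))

  suc-≢ : ∀ {s t} → s ≢ t → s + 1 ≢ t + 1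
  suc-≢ s≢t eq = s≢t (suc-injective (trans (sym (+1≡suc _)) (trans eq (+1≡suc _))))

  not-antipodal : ∀ {s t} → s ≢ t + d → s + 1 ≢ t + 1 + m ∸ 1
  not-antipodal s≢t+d eq = s≢t+d (suc-injective (trans (sym (+1≡suc _)) (trans eq (+1+m∸1 _))))

  yy-adjacent : ∀ (i j : Fin N) → toℕ i ≢ toℕ j → toℕ j ≢ toℕ i + d → toℕ i ≢ toℕ j + d
    → Adj m (yv i) (yv j)
  yy-adjacent i j i≢j j≢i+d i≢j+d with <-cmp (toℕ i) (toℕ j)
  ... | tri< i<j _ _ = inj₁ (+-monoˡ-< 1 i<j , not-antipodal j≢i+d)
  ... | tri≈ _ i≡j _ = ⊥-elim (i≢j i≡j)
  ... | tri> _ _ j<i = inj₂ (+-monoˡ-< 1 j<i , not-antipodal i≢j+d)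

  yz-edge : ∀ (i : Fin N) (j : Fin M) → YZ (toℕ i) (toℕ j) → Edge m (yv i) (zv j)
  yz-edge i j (inj₁ (j≢i , j≢1+i)) = inj₁ (suc-≢ j≢i , λ eq → suc-≢ j≢1+i (trans eq (+1≡suc _)))
  yz-edge i j (inj₂ (i≡0 , j≡1)) = inj₂ (cong (_+ 1) i≡0 , cong (_+ 1) j≡1)

  zz-edge : ∀ (i j : Fin M) → ZStep (toℕ i) (toℕ j) → Edge m (zv i) (zv j)
  zz-edge i j step = trans (+1≡suc (toℕ j)) (cong suc (trans step (cong (_% M) (sym (+1+m∸2 (toℕ i))))))

  zz-edge⁻¹ : ∀ (i j : Fin M) → Edge m (zv i) (zv j) → ZStep (toℕ i) (toℕ j)
  zz-edge⁻¹ i j e = trans (suc-injective (trans (sym (+1≡suc _)) e)) (cong (_% M) (+1+m∸2 (toℕ i)))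

  zz-adjacent : ∀ (i j : Fin M) → ZStep (toℕ i) (toℕ j) ⊎ ZStep (toℕ j) (toℕ i) → Adj m (zv i) (zv j)
  zz-adjacent i j (inj₁ step) = inj₁ (zz-edge i j step)
  zz-adjacent i j (inj₂ step) = inj₂ (zz-edge j i step)

  record DominatingPair (v : Vtx m) : Set where
    field
      a b : ℕ
      a<2d : a < d + d
      b<2d+1 : b < suc (d + d)
      ya≢v : ∀ i → toℕ i ≡ a → yv i ≢ v
      zb≢v : ∀ j → toℕ j ≡ b → zv j ≢ v
      ya~zb : YZ a b
      antipode~zb : ∀ i → yv i ≢ v → toℕ i ≡ a + d ⊎ a ≡ toℕ i + d → YZ (toℕ i) b
      consecutive~zb : ∀ j → zv j ≢ v → toℕ j ≡ a ⊎ toℕ j ≡ suc a → ZStep (toℕ j) b ⊎ ZStep b (toℕ j)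

  HasTotalDominatingPair : Vtx m → Set
  HasTotalDominatingPair v = ∃ λ (S : List (Vtx m))
    → Unique S × length S ≡ 2 × IsTotalDominatingSet (InMinus v) (AdjMinus m v) S

  twoElementTotalDominatingSet : ∀ {v s t} → s ≢ t → s ≢ v → t ≢ v
    → (∀ w → w ≢ v → Any (AdjMinus m v w) (s ∷ t ∷ [])) → HasTotalDominatingPair v
  twoElementTotalDominatingSet s≢t s≢v t≢v dominated =
    (_ ∷ _ ∷ []) , (s≢t ∷ []) ∷ [] ∷ [] , refl , (s≢v ∷ t≢v ∷ []) , dominated

  dominatingPair⇒totalDominatingPair : ∀ {v} → DominatingPair v → HasTotalDominatingPair v
  dominatingPair⇒totalDominatingPair {v} P with yIndex a a<2d | zIndex b b<2d+1
    where open DominatingPair P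
  ... | i , refl | j , refl =
    twoElementTotalDominatingSet (λ ()) (ya≢v i refl) (zb≢v j refl) dominated
    where
    open DominatingPair P
    yi~zj : Edge m (yv i) (zv j)
    yi~zj = yz-edge i j ya~zb
    byYa : ∀ {w} → w ≢ v → Adj m w (yv i) → Any (AdjMinus m v w) (yv i ∷ zv j ∷ [])
    byYa w≢v w~ya = here (w≢v , ya≢v i refl , w~ya)
    byZb : ∀ {w} → w ≢ v → Adj m w (zv j) → Any (AdjMinus m v w) (yv i ∷ zv j ∷ [])
    byZb w≢v w~zb = there (here (w≢v , zb≢v j refl , w~zb))
    dominated : ∀ w → w ≢ v → Any (AdjMinus m v w) (yv i ∷ zv j ∷ [])
    dominated vx w≢v = byYa w≢v (inj₁ tt)
    dominated vy w≢v = byYa w≢v (inj₂ tt)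
    dominated vz w≢v = byZb w≢v (inj₂ tt)
    dominated (yv k) w≢v with k Fin.≟ i | toℕ k ≟ toℕ i + d | toℕ i ≟ toℕ k + d
    ... | yes refl | _ | _ = byZb w≢v (inj₁ yi~zj)
    ... | no _ | yes k≡i+d | _ = byZb w≢v (inj₁ (yz-edge k j (antipode~zb k w≢v (inj₁ k≡i+d))))
    ... | no _ | no _ | yes i≡k+d = byZb w≢v (inj₁ (yz-edge k j (antipode~zb k w≢v (inj₂ i≡k+d))))
    ... | no k≢i | no k≢i+d | no i≢k+d = byYa w≢v (yy-adjacent k i (k≢i ∘ toℕ-injective) i≢k+d k≢i+d)
    dominated (zv k) w≢v with k Fin.≟ j | toℕ k ≟ toℕ i | toℕ k ≟ suc (toℕ i)
    ... | yes refl | _ | _ = byYa w≢v (inj₂ yi~zj)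
    ... | no _ | yes k≡i | _ = byZb w≢v (zz-adjacent k j (consecutive~zb k w≢v (inj₁ k≡i)))
    ... | no _ | no _ | yes k≡1+i = byZb w≢v (zz-adjacent k j (consecutive~zb k w≢v (inj₂ k≡1+i)))
    ... | no _ | no k≢i | no k≢1+i = byYa w≢v (inj₂ (yz-edge i k (inj₁ (k≢i , k≢1+i))))

  d<d+d : d < d + d
  d<d+d = m<m+n d (s≤s z≤n)

  x+d≢x : ∀ x → x + d ≢ x
  x+d≢x x eq = m≢1+m+n x (trans (sym eq) (+-suc x (suc n)))

  zv-≢ : ∀ {j k : Fin M} → zv {m} j ≢ zv k → toℕ j ≢ toℕ k
  zv-≢ zj≢zk eq = zj≢zk (cong zv (toℕ-injective eq))

  dominatingPair-yv-low : (k : Fin N) → toℕ k < d → DominatingPair (yv k)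
  dominatingPair-yv-low k k<d = record
    { a = K + d ; b = K ; a<2d = a<2d ; b<2d+1 = m<n⇒m<1+n (<-≤-trans k<d (m≤m+n d d))
    ; ya≢v = λ i i≡a eq → x+d≢x K (trans (sym i≡a) (yv-injective eq)) ; zb≢v = λ _ _ ()
    ; ya~zb = inj₁ ((λ eq → x+d≢x K (sym eq)) , m≢1+m+n K)
    ; antipode~zb = antipode~zb ; consecutive~zb = consecutive~zb }
    where
    K = toℕ k
    a<2d : K + d < d + d
    a<2d = +-monoˡ-< d k<d
    wrap : ∀ s t → suc (s + t) + t ≡ s + suc (t + t)
    wrap = solve-∀
    antipode~zb : ∀ i → yv i ≢ yv k → toℕ i ≡ K + d + d ⊎ K + d ≡ toℕ i + d → YZ (toℕ i) K
    antipode~zb i _ (inj₁ eq) = ⊥-elim (m+n≮n K (d + d) (subst (_< d + d) (trans eq (+-assoc K d d)) (yIndex< i)))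
    antipode~zb i i≢k (inj₂ eq) = ⊥-elim (i≢k (cong yv (toℕ-injective (sym (+-cancelʳ-≡ d K (toℕ i) eq)))))
    consecutive~zb : ∀ j → zv j ≢ yv k → toℕ j ≡ K + d ⊎ toℕ j ≡ suc (K + d) → ZStep (toℕ j) K ⊎ ZStep K (toℕ j)
    consecutive~zb j _ (inj₁ eq) = inj₂ (trans eq (sym (%M-id (m<n⇒m<1+n a<2d))))
    consecutive~zb j _ (inj₂ eq) = inj₁ (sym (trans (cong (λ x → (x + d) % M) eq)
      (trans (cong (_% M) (wrap K d)) (%M-wrap (m<n⇒m<1+n (<-≤-trans k<d (m≤m+n d d)))))))

  dominatingPair-yv-high : (k : Fin N) → d ≤ toℕ k → DominatingPair (yv k)
  dominatingPair-yv-high k d≤k with m≤n⇒∃[o]m+o≡n d≤k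
  ... | r , d+r≡k = record
    { a = r ; b = suc (d + r) ; a<2d = r<2d ; b<2d+1 = s≤s (+-monoʳ-< d r<d)
    ; ya≢v = λ i i≡r eq → m≢1+n+m r (trans (sym i≡r) (trans (yv-injective eq) (sym d+r≡k))) ; zb≢v = λ _ _ ()
    ; ya~zb = inj₁ ((λ eq → m≢1+n+m r (sym eq)) , λ eq → m≢1+n+m r (sym (suc-injective eq)))
    ; antipode~zb = antipode~zb ; consecutive~zb = consecutive~zb }
    where
    r<d : r < d
    r<d = +-cancelˡ-< d r d (subst (_< d + d) (sym d+r≡k) (yIndex< k))
    r<2d : r < d + d
    r<2d = <-≤-trans r<d (m≤m+n d d)
    wrap : ∀ s t → suc (t + s) + t ≡ s + suc (t + t)
    wrap = solve-∀
    antipode~zb : ∀ i → yv i ≢ yv k → toℕ i ≡ r + d ⊎ r ≡ toℕ i + d → YZ (toℕ i) (suc (d + r))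
    antipode~zb i i≢k (inj₁ eq) = ⊥-elim (i≢k (cong yv (toℕ-injective (trans eq (trans (+-comm r d) d+r≡k)))))
    antipode~zb i _ (inj₂ eq) = ⊥-elim (<⇒≱ r<d (subst (d ≤_) (sym eq) (m≤n+m d (toℕ i))))
    consecutive~zb : ∀ j → zv j ≢ yv k → toℕ j ≡ r ⊎ toℕ j ≡ suc r
      → ZStep (toℕ j) (suc (d + r)) ⊎ ZStep (suc (d + r)) (toℕ j)
    consecutive~zb j _ (inj₁ eq) = inj₂ (trans eq (sym (trans (cong (_% M) (wrap r d)) (%M-wrap (m<n⇒m<1+n r<2d)))))
    consecutive~zb j _ (inj₂ eq) = inj₁ (sym (trans (cong (λ x → (x + d) % M) eq)
      (trans (%M-id (s≤s (+-monoˡ-< d r<d))) (cong suc (+-comm r d)))))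

  dominatingPair-zv-low : (k : Fin M) → suc (suc (toℕ k)) ≤ d → DominatingPair (zv k)
  dominatingPair-zv-low k k+2≤d = record
    { a = K ; b = suc (suc (K + d)) ; a<2d = <-≤-trans k<d (m≤m+n d d) ; b<2d+1 = s≤s (+-monoˡ-≤ d k+2≤d)
    ; ya≢v = λ _ _ () ; zb≢v = zb≢v
    ; ya~zb = inj₁ ((λ eq → m≢1+m+n K (trans (sym eq) (cong suc (sym (+-suc K d)))))
                   , λ eq → m≢1+m+n K (suc-injective (sym eq)))
    ; antipode~zb = antipode~zb ; consecutive~zb = consecutive~zb }
    where
    K = toℕ k
    k<d : K < d
    k<d = ≤-trans (n≤1+n _) k+2≤d
    wrap : ∀ s t → suc (suc (s + t)) + t ≡ suc s + suc (t + t)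
    wrap = solve-∀
    zb≢v : ∀ j → toℕ j ≡ suc (suc (K + d)) → zv j ≢ zv k
    zb≢v j eq j≡k = m≢1+m+n K (trans (sym (trans (sym eq) (zv-injective j≡k))) (cong suc (sym (+-suc K d))))
    antipode~zb : ∀ i → yv i ≢ zv k → toℕ i ≡ K + d ⊎ K ≡ toℕ i + d → YZ (toℕ i) (suc (suc (K + d)))
    antipode~zb i _ (inj₁ eq) = inj₁ ((λ e → m≢1+n+m (K + d) {1} (sym (trans e eq)))
                                     , λ e → m≢1+n+m (suc (K + d)) {0} (sym (trans e (cong suc eq))))
    antipode~zb i _ (inj₂ eq) = ⊥-elim (<⇒≱ k<d (subst (d ≤_) (sym eq) (m≤n+m d (toℕ i))))
    consecutive~zb : ∀ j → zv j ≢ zv k → toℕ j ≡ K ⊎ toℕ j ≡ suc K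
      → ZStep (toℕ j) (suc (suc (K + d))) ⊎ ZStep (suc (suc (K + d))) (toℕ j)
    consecutive~zb j j≢k (inj₁ eq) = ⊥-elim (zv-≢ j≢k eq)
    consecutive~zb j _ (inj₂ eq) = inj₂ (trans eq (sym (trans (cong (_% M) (wrap K d))
      (%M-wrap (m<n⇒m<1+n (<-≤-trans k+2≤d (m≤m+n d d)))))))

  dominatingPair-zv[d-1] : (k : Fin M) → toℕ k ≡ suc n → DominatingPair (zv k)
  dominatingPair-zv[d-1] k k≡d-1 = record
    { a = suc n ; b = 0 ; a<2d = <-≤-trans (n<1+n (suc n)) (m≤m+n d d) ; b<2d+1 = s≤s z≤n
    ; ya≢v = λ _ _ () ; zb≢v = λ j j≡0 eq → 0≢1+n (trans (sym j≡0) (trans (zv-injective eq) k≡d-1))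
    ; ya~zb = inj₁ ((λ ()) , (λ ()))
    ; antipode~zb = antipode~zb ; consecutive~zb = consecutive~zb }
    where
    antipode~zb : ∀ i → yv i ≢ zv k → toℕ i ≡ suc n + d ⊎ suc n ≡ toℕ i + d → YZ (toℕ i) 0
    antipode~zb i _ (inj₁ eq) = inj₁ ((λ e → 0≢1+n (trans e eq)) , (λ ()))
    antipode~zb i _ (inj₂ eq) = ⊥-elim (<⇒≱ (n<1+n (suc n)) (subst (d ≤_) (sym eq) (m≤n+m d (toℕ i))))
    consecutive~zb : ∀ j → zv j ≢ zv k → toℕ j ≡ suc n ⊎ toℕ j ≡ d → ZStep (toℕ j) 0 ⊎ ZStep 0 (toℕ j)
    consecutive~zb j j≢k (inj₁ eq) = ⊥-elim (zv-≢ j≢k (trans eq (sym k≡d-1)))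
    consecutive~zb j _ (inj₂ eq) = inj₂ (trans eq (sym (%M-id (m<n⇒m<1+n d<d+d))))

  -- Here the antipode y_0 of y_d reaches z_1 only through the extra edge y_1 z_2.
  dominatingPair-zv[d] : (k : Fin M) → toℕ k ≡ d → DominatingPair (zv k)
  dominatingPair-zv[d] k k≡d = record
    { a = d ; b = 1 ; a<2d = d<d+d ; b<2d+1 = s≤s (s≤s z≤n)
    ; ya≢v = λ _ _ () ; zb≢v = λ j j≡1 eq → 0≢1+n (suc-injective (trans (sym j≡1) (trans (zv-injective eq) k≡d)))
    ; ya~zb = inj₁ ((λ ()) , (λ ()))
    ; antipode~zb = antipode~zb ; consecutive~zb = consecutive~zb }
    where
    antipode~zb : ∀ i → yv i ≢ zv k → toℕ i ≡ d + d ⊎ d ≡ toℕ i + d → YZ (toℕ i) 1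
    antipode~zb i _ (inj₁ eq) = ⊥-elim (<-irrefl eq (yIndex< i))
    antipode~zb i _ (inj₂ eq) = inj₂ (+-cancelʳ-≡ d (toℕ i) 0 (sym eq) , refl)
    consecutive~zb : ∀ j → zv j ≢ zv k → toℕ j ≡ d ⊎ toℕ j ≡ suc d → ZStep (toℕ j) 1 ⊎ ZStep 1 (toℕ j)
    consecutive~zb j j≢k (inj₁ eq) = ⊥-elim (zv-≢ j≢k (trans eq (sym k≡d)))
    consecutive~zb j _ (inj₂ eq) = inj₂ (trans eq (sym (%M-id (s≤s d<d+d))))

  dominatingPair-zv[d+1] : (k : Fin M) → toℕ k ≡ suc d → DominatingPair (zv k)
  dominatingPair-zv[d+1] k k≡d+1 = record
    { a = d ; b = d + d ; a<2d = d<d+d ; b<2d+1 = n<1+n (d + d)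
    ; ya≢v = λ _ _ () ; zb≢v = λ j j≡2d eq → <⇒≢ d+1<2d (trans (sym k≡d+1) (trans (sym (zv-injective eq)) j≡2d))
    ; ya~zb = inj₁ ((λ eq → <⇒≢ d<d+d (sym eq)) , λ eq → <⇒≢ d+1<2d (sym eq))
    ; antipode~zb = antipode~zb ; consecutive~zb = consecutive~zb }
    where
    d+1<2d : suc d < d + d
    d+1<2d = s≤s (s≤s (m≤n+m d n))
    antipode~zb : ∀ i → yv i ≢ zv k → toℕ i ≡ d + d ⊎ d ≡ toℕ i + d → YZ (toℕ i) (d + d)
    antipode~zb i _ (inj₁ eq) = ⊥-elim (<-irrefl eq (yIndex< i))
    antipode~zb i _ (inj₂ eq) =
      subst (λ t → YZ t (d + d)) (sym (+-cancelʳ-≡ d (toℕ i) 0 (sym eq))) (inj₁ ((λ ()) , (λ ())))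
    consecutive~zb : ∀ j → zv j ≢ zv k → toℕ j ≡ d ⊎ toℕ j ≡ suc d → ZStep (toℕ j) (d + d) ⊎ ZStep (d + d) (toℕ j)
    consecutive~zb j _ (inj₁ eq) = inj₁ (sym (trans (cong (λ x → (x + d) % M) eq) (%M-id (n<1+n (d + d)))))
    consecutive~zb j j≢k (inj₂ eq) = ⊥-elim (zv-≢ j≢k (trans eq (sym k≡d+1)))

  dominatingPair-zv-high : (k : Fin M) → suc (suc d) ≤ toℕ k → DominatingPair (zv k)
  dominatingPair-zv-high k d+2≤k with m≤n⇒∃[o]m+o≡n d+2≤k
  ... | r , d+2+r≡k = record
    { a = suc (d + r) ; b = r ; a<2d = a<2d ; b<2d+1 = r<2d+1
    ; ya≢v = λ _ _ () ; zb≢v = λ j j≡r eq → m≢1+n+m r {suc d} (trans (sym j≡r) (trans (zv-injective eq) (sym d+2+r≡k)))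
    ; ya~zb = inj₁ (m≢1+n+m r , m≢1+n+m r {suc d})
    ; antipode~zb = antipode~zb ; consecutive~zb = consecutive~zb }
    where
    a<2d : suc (d + r) < d + d
    a<2d = s≤s⁻¹ (subst (_< suc (d + d)) (sym d+2+r≡k) (zIndex< k))
    r+2≤d : suc (suc r) ≤ d
    r+2≤d = +-cancelˡ-≤ d (suc (suc r)) d (subst (_≤ d + d) (sym (trans (+-suc d (suc r)) (cong suc (+-suc d r)))) a<2d)
    r<2d+1 : r < suc (d + d)
    r<2d+1 = m<n⇒m<1+n (<-≤-trans (≤-trans (n≤1+n _) r+2≤d) (m≤m+n d d))
    wrap : ∀ s t → suc (t + s) + t ≡ s + suc (t + t)
    wrap = solve-∀
    antipode~zb : ∀ i → yv i ≢ zv k → toℕ i ≡ suc (d + r) + d ⊎ suc (d + r) ≡ toℕ i + d → YZ (toℕ i) r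
    antipode~zb i _ (inj₁ eq) =
      ⊥-elim (<⇒≱ (yIndex< i) (subst (d + d ≤_) (sym eq) (m≤n⇒m≤1+n (+-monoˡ-≤ d (m≤m+n d r)))))
    antipode~zb i _ (inj₂ eq) = subst (λ t → YZ t r) (+-cancelʳ-≡ d (suc r) (toℕ i) (trans (cong suc (+-comm r d)) eq))
                                  (inj₁ (m≢1+n+m r {0} , m≢1+n+m r {1}))
    consecutive~zb : ∀ j → zv j ≢ zv k → toℕ j ≡ suc (d + r) ⊎ toℕ j ≡ suc (suc (d + r)) → ZStep (toℕ j) r ⊎ ZStep r (toℕ j)
    consecutive~zb j _ (inj₁ eq) = inj₁ (sym (trans (cong (λ x → (x + d) % M) eq) (trans (cong (_% M) (wrap r d)) (%M-wrap r<2d+1))))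
    consecutive~zb j j≢k (inj₂ eq) = ⊥-elim (zv-≢ j≢k (trans eq d+2+r≡k))

  dominatingPair-yv : (k : Fin N) → DominatingPair (yv k)
  dominatingPair-yv k with toℕ k <? d
  ... | yes k<d = dominatingPair-yv-low k k<d
  ... | no k≮d = dominatingPair-yv-high k (≮⇒≥ k≮d)

  dominatingPair-zv : (k : Fin M) → DominatingPair (zv k)
  dominatingPair-zv k with suc (suc (toℕ k)) ≤? d | toℕ k ≟ suc n | toℕ k ≟ d | toℕ k ≟ suc d
  ... | yes k+2≤d | _ | _ | _ = dominatingPair-zv-low k k+2≤d
  ... | no _ | yes k≡d-1 | _ | _ = dominatingPair-zv[d-1] k k≡d-1
  ... | no _ | no _ | yes k≡d | _ = dominatingPair-zv[d] k k≡d
  ... | no _ | no _ | no _ | yes k≡d+1 = dominatingPair-zv[d+1] k k≡d+1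
  ... | no k+2≰d | no k≢d-1 | no k≢d | no k≢d+1 = dominatingPair-zv-high k d+2≤k
    where
    d+2≤k : suc (suc d) ≤ toℕ k
    d+2≤k = ≤∧≢⇒< (≤∧≢⇒< (≤∧≢⇒< (s≤s⁻¹ (s≤s⁻¹ (≰⇒> k+2≰d))) (k≢d-1 ∘ sym)) (k≢d ∘ sym)) (k≢d+1 ∘ sym)

  totalDominatingPair : (v : Vtx m) → HasTotalDominatingPair v
  totalDominatingPair vx = twoElementTotalDominatingSet (λ ()) (λ ()) (λ ()) dominated
    where
    dominated : ∀ w → w ≢ vx → Any (AdjMinus m vx w) (vy ∷ vz ∷ [])
    dominated vx w≢x = ⊥-elim (w≢x refl)
    dominated vy w≢x = there (here (w≢x , (λ ()) , inj₁ tt))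
    dominated vz w≢x = here (w≢x , (λ ()) , inj₂ tt)
    dominated (yv _) w≢x = here (w≢x , (λ ()) , inj₁ tt)
    dominated (zv _) w≢x = there (here (w≢x , (λ ()) , inj₁ tt))
  totalDominatingPair vy = twoElementTotalDominatingSet (λ ()) (λ ()) (λ ()) dominated
    where
    dominated : ∀ w → w ≢ vy → Any (AdjMinus m vy w) (vx ∷ zv Fin.zero ∷ [])
    dominated vx w≢y = there (here (w≢y , (λ ()) , inj₁ tt))
    dominated vy w≢y = ⊥-elim (w≢y refl)
    dominated vz w≢y = there (here (w≢y , (λ ()) , inj₂ tt))
    dominated (yv _) w≢y = here (w≢y , (λ ()) , inj₂ tt)
    dominated (zv _) w≢y = here (w≢y , (λ ()) , inj₂ tt)
  totalDominatingPair vz = twoElementTotalDominatingSet (λ ()) (λ ()) (λ ()) dominated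
    where
    dominated : ∀ w → w ≢ vz → Any (AdjMinus m vz w) (vx ∷ yv Fin.zero ∷ [])
    dominated vx w≢z = there (here (w≢z , (λ ()) , inj₁ tt))
    dominated vy w≢z = there (here (w≢z , (λ ()) , inj₂ tt))
    dominated vz w≢z = ⊥-elim (w≢z refl)
    dominated (yv _) w≢z = here (w≢z , (λ ()) , inj₂ tt)
    dominated (zv _) w≢z = here (w≢z , (λ ()) , inj₂ tt)
  totalDominatingPair (yv k) = dominatingPair⇒totalDominatingPair (dominatingPair-yv k)
  totalDominatingPair (zv k) = dominatingPair⇒totalDominatingPair (dominatingPair-zv k)

  -- (t + d) mod (2d+1) is t + d or t - d - 1, and neither equals t.
  ZStep-irreflexive : ∀ {t} → t < suc (d + d) → ¬ ZStep t t
  ZStep-irreflexive {t} t<2d+1 t≡t+d with t + d <? suc (d + d)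
  ... | yes no-wrap = x+d≢x t (sym (trans t≡t+d (%M-id no-wrap)))
  ... | no wraps with m≤n⇒∃[o]m+o≡n (≮⇒≥ wraps)
  ...   | s , 2d+1+s≡t+d = <⇒≢ (m<n⇒m<1+n d<d+d) (+-cancelˡ-≡ t d (suc (d + d)) t+d≡t+2d+1)
    where
    t+d≡s+2d+1 : t + d ≡ s + suc (d + d)
    t+d≡s+2d+1 = trans (sym 2d+1+s≡t+d) (+-comm (suc (d + d)) s)
    s≤t : s ≤ t
    s≤t = +-cancelʳ-≤ (suc (d + d)) s t (subst (_≤ t + suc (d + d)) t+d≡s+2d+1 (+-monoʳ-≤ t (m≤n⇒m≤1+n (m≤m+n d d))))
    s<2d+1 : s < suc (d + d)
    s<2d+1 = ≤-<-trans s≤t t<2d+1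
    t≡s : t ≡ s
    t≡s = trans t≡t+d (trans (cong (_% M) t+d≡s+2d+1) (%M-wrap s<2d+1))
    t+d≡t+2d+1 : t + d ≡ t + suc (d + d)
    t+d≡t+2d+1 = trans t+d≡s+2d+1 (cong (_+ suc (d + d)) (sym t≡s))

  Edge-irreflexive : ∀ u → ¬ Edge m u u
  Edge-irreflexive vx ()
  Edge-irreflexive vy ()
  Edge-irreflexive vz ()
  Edge-irreflexive (yv i) (i<i , _) = <-irrefl refl i<i
  Edge-irreflexive (zv j) e = ZStep-irreflexive (zIndex< j) (zz-edge⁻¹ j j e)

  Adj-irreflexive : ∀ u → ¬ Adj m u u
  Adj-irreflexive u (inj₁ e) = Edge-irreflexive u e
  Adj-irreflexive u (inj₂ e) = Edge-irreflexive u e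

  otherVertex : (v : Vtx m) → ∃ λ w → w ≢ v
  otherVertex vx = vy , λ ()
  otherVertex vy = vx , λ ()
  otherVertex vz = vx , λ ()
  otherVertex (yv _) = vx , λ ()
  otherVertex (zv _) = vx , λ ()

lemma2p7 : (m : ℕ) → 3 ≤ m → (v : Vtx m)
    → TotalDominationNumber (InMinus v) (AdjMinus m v) 2
lemma2p7 (suc (suc (suc n))) (s≤s (s≤s (s≤s z≤n))) v =
  totalDominatingPair v ,
  λ S _ → totalDominatingSet-length≥2 (λ u (u≢v , _ , u~u) → Adj-irreflexive u u~u) (otherVertex v) S
  where open G₄ₘ n
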